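{- Let $\mathcal{L}$ be a first-order alphabet, $P$ a definite clause program over $\mathcal{L}$, $Q$ an atomic query over $\mathcal{L}$, $\sigma$ a substitution, and $\mathit{magic}(P,Q)$ the magic program defined in the context. If $P\models Q\sigma$ then $\mathit{magic}(P,Q)\models Q\sigma$.
   Context: Magic transformation: the alphabet $\mathcal{L}$ is extended with a new predicate symbol $\hat p$ for each predicate symbol $p$ of $\mathcal{L}$; for each $p$ some $k_p$ argument positions $i_1<\dots<i_{k_p}$ of $p$ are selected, and $\hat p$ has arity $k_p$. For an atom $A=p(t_1,\dots,t_n)$ over $\mathcal{L}$, $\hat A$ denotes $\hat p(t_{i_1},\dots,t_{i_{k_p}})$. The program $\mathit{magic}(P,Q)$ consists of: (1) a clause $H\gets \hat H, B_1,\dots,B_n$ for each clause $H\gets B_1,\dots,B_n$ of $P$; (2) a clause $\hat B_i\gets \hat H, B_1,\dots,B_{i-1}$ for each clause $H\gets B_1,\dots,B_n$ of $P$ and each $i=1,\dots,n$; (3) the unit clause $\hat Q\gets$. -}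

module Defs where

open import Data.Nat using (ℕ; zero; suc)
open import Data.Bool using (Bool; true; false)
open import Data.Vec using (Vec; []; _∷_)
open import Data.List using (List; []; _∷_; _++_; [_])
open import Data.List.Relation.Unary.All using (All)
open import Data.Sum using (_⊎_; inj₁; inj₂)
open import Data.Product using (Σ; _×_; _,_)

record Alphabet : Set₁ where
  field
    Fun   : Set
    farity : Fun → ℕ
    Pred  : Set
    parity : Pred → ℕ
open Alphabet public

data Term (F : Set) (fa : F → ℕ) : Set where
  var : ℕ → Term F fa
  fn  : (f : F) → Vec (Term F fa) (fa f) → Term F fa

Tm : Alphabet → Set
Tm L = Term (Fun L) (farity L)

record Atom (L : Alphabet) : Set where
  constructor atom
  field
    pred : Pred L
    args : Vec (Tm L) (parity L pred)

record Clause (L : Alphabet) : Set where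
  constructor _⇐_
  field
    head : Atom L
    body : List (Atom L)

Program : Alphabet → Set
Program L = List (Clause L)

Subst : Alphabet → Set
Subst L = ℕ → Tm L

module _ {F : Set} {fa : F → ℕ} (σ : ℕ → Term F fa) where
  substT  : Term F fa → Term F fa
  substTs : ∀ {n} → Vec (Term F fa) n → Vec (Term F fa) n
  substT (var x)   = σ x
  substT (fn f ts) = fn f (substTs ts)
  substTs []       = []
  substTs (t ∷ ts) = substT t ∷ substTs ts

_·_ : ∀ {L} → Atom L → Subst L → Atom L
atom p ts · σ = atom p (substTs σ ts)

record Interpretation (L : Alphabet) : Set₁ where
  field
    Dom  : Set
    fun  : (f : Fun L) → Vec Dom (farity L f) → Dom
    rel  : (p : Pred L) → Vec Dom (parity L p) → Set
open Interpretation public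

module _ {L : Alphabet} (I : Interpretation L) (v : ℕ → Dom I) where
  evalT  : Tm L → Dom I
  evalTs : ∀ {n} → Vec (Tm L) n → Vec (Dom I) n
  evalT (var x)   = v x
  evalT (fn f ts) = fun I f (evalTs ts)
  evalTs []       = []
  evalTs (t ∷ ts) = evalT t ∷ evalTs ts

  holds : Atom L → Set
  holds (atom p ts) = rel I p (evalTs ts)

TrueAtom : ∀ {L} → Interpretation L → Atom L → Set
TrueAtom I A = ∀ v → holds I v A

TrueClause : ∀ {L} → Interpretation L → Clause L → Set
TrueClause I (H ⇐ B) = ∀ v → All (holds I v) B → holds I v H

IsModel : ∀ {L} → Interpretation L → Program L → Set
IsModel I P = All (TrueClause I) P

_⊨_ : ∀ {L} → Program L → Atom L → Set₁
P ⊨ A = ∀ (I : Interpretation _) → IsModel I P → TrueAtom I A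

-- selection of argument positions of each predicate: a subset of the
-- positions given as a Bool vector; selected positions are kept in order.
Selection : Alphabet → Set
Selection L = (p : Pred L) → Vec Bool (parity L p)

count : ∀ {n} → Vec Bool n → ℕ
count []           = zero
count (true ∷ bs)  = suc (count bs)
count (false ∷ bs) = count bs

select : ∀ {A : Set} {n} (bs : Vec Bool n) → Vec A n → Vec A (count bs)
select []           []       = []
select (true ∷ bs)  (x ∷ xs) = x ∷ select bs xs
select (false ∷ bs) (x ∷ xs) = select bs xs

-- extended alphabet: predicates p (inj₁ p) and p̂ (inj₂ p)
extend : (L : Alphabet) → Selection L → Alphabet
extend L s = record
  { Fun = Fun L ; farity = farity L ; Pred = Pred L ⊎ Pred L ; parity = ar }
  where
    ar : Pred L ⊎ Pred L → ℕ
    ar (inj₁ p) = parity L p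
    ar (inj₂ p) = count (s p)

module Magic (L : Alphabet) (s : Selection L) where
  L̂ : Alphabet
  L̂ = extend L s

  ⌜_⌝ : Atom L → Atom L̂
  ⌜ atom p ts ⌝ = atom (inj₁ p) ts

  hat : Atom L → Atom L̂
  hat (atom p ts) = atom (inj₂ p) (select (s p) ts)

  embedAll : List (Atom L) → List (Atom L̂)
  embedAll []       = []
  embedAll (A ∷ As) = ⌜ A ⌝ ∷ embedAll As

  -- clauses  B̂ᵢ ← Ĥ, pre, B₁,…,Bᵢ₋₁  (pre accumulates B₁,…,Bᵢ₋₁)
  magicBody : Atom L → List (Atom L) → List (Atom L) → List (Clause L̂)
  magicBody H pre []       = []
  magicBody H pre (B ∷ Bs) =
    (hat B ⇐ (hat H ∷ embedAll pre)) ∷ magicBody H (pre ++ [ B ]) Bs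

  clauseMagic : Clause L → List (Clause L̂)
  clauseMagic (H ⇐ B) = (⌜ H ⌝ ⇐ (hat H ∷ embedAll B)) ∷ magicBody H [] B

  magicClauses : Program L → List (Clause L̂)
  magicClauses []       = []
  magicClauses (C ∷ P)  = clauseMagic C ++ magicClauses P

  magic : Program L → Atom L → Program L̂
  magic P Q = magicClauses P ++ [ hat Q ⇐ [] ]

-- Given a model I of magic(P,Q), reinterpret every predicate p of L over the
-- same domain as "p̂ implies p", i.e. p(d) holds iff I ⊨ p̂(d') → p(d) with d'
-- the selected arguments of d. This is a model of P: if the head's magic atom
-- holds, the magic clauses make each body atom's magic atom hold in turn, so
-- each body atom holds in I, and then so does the head. Hence Qσ is true in it,
-- and since I ⊨ Q̂ (the unit clause, instantiated by σ), I ⊨ Qσ.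
module Submission where

open import Defs
open import Data.Nat using (ℕ)
open import Data.Bool using (Bool; true; false)
open import Data.Vec using (Vec; []; _∷_; map)
open import Data.List using (List; []; _∷_; _++_; [_])
open import Data.List.Relation.Unary.All using (All; []; _∷_)
open import Data.List.Relation.Unary.All.Properties using (++⁺; ++⁻ˡ; ++⁻ʳ)
open import Data.Sum using (inj₁; inj₂)
open import Function using (id; _∘_)
open import Relation.Binary.PropositionalEquality
  using (_≡_; refl; sym; cong; cong₂; subst; module ≡-Reasoning)
open ≡-Reasoning

select-map : ∀ {A B : Set} {n} (f : A → B) (bs : Vec Bool n) (xs : Vec A n) →
  select bs (map f xs) ≡ map f (select bs xs)
select-map f []           []       = refl
select-map f (true ∷ bs)  (x ∷ xs) = cong (f x ∷_) (select-map f bs xs)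
select-map f (false ∷ bs) (x ∷ xs) = select-map f bs xs

substTs≡map : ∀ {F : Set} {fa : F → ℕ} (σ : ℕ → Term F fa) {n}
  (ts : Vec (Term F fa) n) → substTs σ ts ≡ map (substT σ) ts
substTs≡map σ []       = refl
substTs≡map σ (t ∷ ts) = cong (substT σ t ∷_) (substTs≡map σ ts)

module _ {L : Alphabet} (I : Interpretation L) where

  evalTs≡map : ∀ v {n} (ts : Vec (Tm L) n) → evalTs I v ts ≡ map (evalT I v) ts
  evalTs≡map v []       = refl
  evalTs≡map v (t ∷ ts) = cong (evalT I v t ∷_) (evalTs≡map v ts)

  evalTs-select : ∀ v {n} (bs : Vec Bool n) (ts : Vec (Tm L) n) →
    evalTs I v (select bs ts) ≡ select bs (evalTs I v ts)
  evalTs-select v bs ts = begin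
    evalTs I v (select bs ts)        ≡⟨ evalTs≡map v (select bs ts) ⟩
    map (evalT I v) (select bs ts)   ≡⟨ sym (select-map (evalT I v) bs ts) ⟩
    select bs (map (evalT I v) ts)   ≡⟨ cong (select bs) (sym (evalTs≡map v ts)) ⟩
    select bs (evalTs I v ts)        ∎

  evalT-substT : ∀ σ v (t : Tm L) →
    evalT I v (substT σ t) ≡ evalT I (evalT I v ∘ σ) t
  evalTs-substTs : ∀ σ v {n} (ts : Vec (Tm L) n) →
    evalTs I v (substTs σ ts) ≡ evalTs I (evalT I v ∘ σ) ts
  evalT-substT σ v (var x)   = refl
  evalT-substT σ v (fn f ts) = cong (fun I f) (evalTs-substTs σ v ts)
  evalTs-substTs σ v []       = refl
  evalTs-substTs σ v (t ∷ ts) =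
    cong₂ _∷_ (evalT-substT σ v t) (evalTs-substTs σ v ts)

  holds-· : ∀ v σ (A : Atom L) → holds I v (A · σ) ≡ holds I (evalT I v ∘ σ) A
  holds-· v σ (atom p ts) = cong (rel I p) (evalTs-substTs σ v ts)

  TrueAtom-· : ∀ {A : Atom L} → TrueAtom I A → ∀ σ → TrueAtom I (A · σ)
  TrueAtom-· {A} ⊨A σ v = subst id (sym (holds-· v σ A)) (⊨A (evalT I v ∘ σ))

module _ (L : Alphabet) (s : Selection L) where
  open Magic L s

  hat-· : (A : Atom L) (σ : Subst L) → hat (A · σ) ≡ hat A · σ
  hat-· (atom p ts) σ = cong (atom (inj₂ p)) (begin
    select (s p) (substTs σ ts)          ≡⟨ cong (select (s p)) (substTs≡map σ ts) ⟩
    select (s p) (map (substT σ) ts)     ≡⟨ select-map (substT σ) (s p) ts ⟩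
    map (substT σ) (select (s p) ts)     ≡⟨ sym (substTs≡map σ (select (s p) ts)) ⟩
    substTs σ (select (s p) ts)          ∎)

  embedAll-++ : (As Bs : List (Atom L)) →
    embedAll (As ++ Bs) ≡ embedAll As ++ embedAll Bs
  embedAll-++ []       Bs = refl
  embedAll-++ (A ∷ As) Bs = cong (⌜ A ⌝ ∷_) (embedAll-++ As Bs)

  module _ (I : Interpretation L̂) where

    hatImplies : Interpretation L
    hatImplies = record
      { Dom = Dom I
      ; fun = fun I
      ; rel = λ p ds → rel I (inj₂ p) (select (s p) ds) → rel I (inj₁ p) ds
      }

    evalT-hatImplies : ∀ v (t : Tm L) → evalT hatImplies v t ≡ evalT I v t
    evalTs-hatImplies : ∀ v {n} (ts : Vec (Tm L) n) →
      evalTs hatImplies v ts ≡ evalTs I v ts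
    evalT-hatImplies v (var x)   = refl
    evalT-hatImplies v (fn f ts) = cong (fun I f) (evalTs-hatImplies v ts)
    evalTs-hatImplies v []       = refl
    evalTs-hatImplies v (t ∷ ts) =
      cong₂ _∷_ (evalT-hatImplies v t) (evalTs-hatImplies v ts)

    holds-hatImplies : ∀ v (A : Atom L) →
      holds hatImplies v A ≡ (holds I v (hat A) → holds I v ⌜ A ⌝)
    holds-hatImplies v (atom p ts) =
      cong₂ (λ ds es → rel I (inj₂ p) ds → rel I (inj₁ p) es)
        (begin
          select (s p) (evalTs hatImplies v ts) ≡⟨ cong (select (s p)) (evalTs-hatImplies v ts) ⟩
          select (s p) (evalTs I v ts)          ≡⟨ sym (evalTs-select I v (s p) ts) ⟩
          evalTs I v (select (s p) ts)          ∎)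
        (evalTs-hatImplies v ts)

    magicBody-sound : ∀ v H pre Bs → holds I v (hat H) →
      All (holds I v) (embedAll pre) → All (TrueClause I) (magicBody H pre Bs) →
      All (holds hatImplies v) Bs → All (holds I v) (embedAll Bs)
    magicBody-sound v H pre []       Ĥ ⊨pre []          []          = []
    magicBody-sound v H pre (B ∷ Bs) Ĥ ⊨pre (⊨B̂ ∷ ⊨Bŝ) (⊨B ∷ ⊨Bs) =
      ⊨⌜B⌝ ∷ magicBody-sound v H (pre ++ [ B ]) Bs Ĥ ⊨pre++B ⊨Bŝ ⊨Bs
      where
      ⊨⌜B⌝ : holds I v ⌜ B ⌝
      ⊨⌜B⌝ = subst id (holds-hatImplies v B) ⊨B (⊨B̂ v (Ĥ ∷ ⊨pre))
      ⊨pre++B : All (holds I v) (embedAll (pre ++ [ B ]))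
      ⊨pre++B = subst (All (holds I v)) (sym (embedAll-++ pre [ B ]))
                      (++⁺ ⊨pre (⊨⌜B⌝ ∷ []))

    clauseMagic-sound : ∀ C → All (TrueClause I) (clauseMagic C) →
      TrueClause hatImplies C
    clauseMagic-sound (H ⇐ B) (⊨H ∷ ⊨magic) v ⊨B =
      subst id (sym (holds-hatImplies v H))
        (λ Ĥ → ⊨H v (Ĥ ∷ magicBody-sound v H [] B Ĥ [] ⊨magic ⊨B))

    hatImplies-isModel : ∀ P → All (TrueClause I) (magicClauses P) →
      IsModel hatImplies P
    hatImplies-isModel []      _ = []
    hatImplies-isModel (C ∷ P) ⊨CP =
      clauseMagic-sound C (++⁻ˡ (clauseMagic C) ⊨CP)
        ∷ hatImplies-isModel P (++⁻ʳ (clauseMagic C) ⊨CP)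

corollary1 : (L : Alphabet) (s : Selection L) (P : Program L) (Q : Atom L)
    (σ : Subst L) → P ⊨ (Q · σ) →
    Magic.magic L s P Q ⊨ Magic.⌜_⌝ L s (Q · σ)
corollary1 L s P Q σ P⊨Qσ I ⊨magic v =
  subst id (holds-hatImplies L s I v (Q · σ)) (P⊨Qσ J J⊨P v) Q̂σ
  where
  open Magic L s
  J : Interpretation L
  J = hatImplies L s I
  J⊨P : IsModel J P
  J⊨P = hatImplies-isModel L s I P (++⁻ˡ (magicClauses P) ⊨magic)
  ⊨Q̂ : TrueAtom I (hat Q)
  ⊨Q̂ with ++⁻ʳ (magicClauses P) ⊨magic
  ... | ⊨fact ∷ [] = λ w → ⊨fact w []
  Q̂σ : holds I v (hat (Q · σ))
  Q̂σ = subst (holds I v) (sym (hat-· L s Q σ)) (TrueAtom-· I ⊨Q̂ σ v)
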